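{- Let $m\geq 2$, let $\Gamma$ be a set of fluted $m$-clauses over a signature $\Sigma\cup\{\mathfrak{t}\}$, let $\Sigma'$ be the result of removing all predicates of arity $m$ from $\Sigma$, and let $\tau^-$ be a fluted $m$-type over $\Sigma'\cup\{\mathfrak{t}\}$. If $\tau^-$ is consistent with $\Gamma^\circ$, then there exists a fluted $m$-type $\tau$ over $\Sigma\cup\{\mathfrak{t}\}$ such that $\tau\supseteq\tau^-$ and $\tau$ is consistent with $\Gamma$.
   Context: $\Sigma$ is a signature of predicates of positive arity not containing the distinguished binary predicate $\mathfrak{t}$ (interpreted as a transitive relation); no equality. Fix variables $x_1,x_2,\ldots$. A fluted $m$-atom over $\Sigma\cup\{\mathfrak{t}\}$ is an atom $p(x_h,x_{h+1},\ldots,x_m)$ ($1\leq h\leq m$) with $p\in\Sigma\cup\{\mathfrak{t}\}$ of arity $m-h+1$; a fluted $m$-literal is such an atom or its negation; a fluted $m$-clause is a disjunction of fluted $m$-literals (the empty clause $\bot$ included; duplicates and order of literals disregarded); a fluted $m$-type is a maximal consistent set of fluted $m$-literals (identified with its conjunction). Fluted resolution: if $p\in\Sigma$ has arity $m$ and $p(x_1,\ldots,x_m)\vee\gamma'$ and $\neg p(x_1,\ldots,x_m)\vee\delta'$ are fluted $m$-clauses, then $\gamma'\vee\delta'$ is their fluted resolvent. $\Gamma^*$ is the smallest set of fluted $m$-clauses containing $\Gamma$ and closed under fluted resolution, and $\Gamma^\circ$ is obtained from $\Gamma^*$ by deleting every clause containing a predicate of $\Sigma$ of arity $m$. A set of literals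 is consistent with a set of clauses if their conjunction is satisfiable. -}

module Defs where

open import Data.Nat using (ℕ; zero; suc; _≤_; _∸_; _+_)
open import Data.Fin using (Fin; toℕ)
open import Data.Bool using (Bool; true; false)
open import Data.Vec using (Vec; []; _∷_; tabulate)
open import Data.List using (List; []; _∷_; _++_)
open import Data.List.Relation.Unary.All using (All)
open import Data.List.Relation.Unary.Any using (Any)
open import Data.List.Membership.Propositional using (_∈_)
open import Data.List.Relation.Binary.Subset.Propositional using (_⊆_)
open import Data.Product using (Σ; _×_)
open import Data.Empty using (⊥)
open import Data.Unit using (⊤)
open import Relation.Nullary using (¬_)
open import Relation.Binary.PropositionalEquality using (_≡_)

data Pred (k : ℕ) : Set where
  sig : Fin k → Pred k
  𝔱   : Pred k

module Fluted (k : ℕ) (ar : Fin k → ℕ) (m : ℕ) where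

  arity : Pred k → ℕ
  arity (sig i) = ar i
  arity 𝔱       = 2

  -- A fluted m-atom p(x_h,…,x_m) with arity p = m-h+1 (1 ≤ h ≤ m) is
  -- determined by p, and exists iff arity p ≤ m (arities are positive).
  record Atom : Set where
    constructor atom
    field
      pred  : Pred k
      bound : arity pred ≤ m

  record Literal : Set where
    constructor lit
    field
      positive : Bool
      atm      : Atom

  litPred : Literal → Pred k
  litPred l = Atom.pred (Literal.atm l)

  -- fluted m-clause: disjunction of its literals (order/duplicates irrelevant
  -- semantically; set-equality handled explicitly in Star below)
  Clause : Set
  Clause = List Literal

  record Structure : Set₁ where
    field
      Dom   : Set
      rel   : (p : Pred k) → Vec Dom (arity p) → Set
      trans : ∀ a b c → rel 𝔱 (a ∷ b ∷ []) → rel 𝔱 (b ∷ c ∷ []) →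
              rel 𝔱 (a ∷ c ∷ [])

  open Structure public

  -- ρ i is the value of the variable x_i (i ≥ 1);
  -- the arguments of an a-ary fluted m-atom are x_{m-a+1}, …, x_m
  args : (M : Structure) → (ℕ → Dom M) → (a : ℕ) → Vec (Dom M) a
  args M ρ a = tabulate (λ j → ρ (m ∸ a + suc (toℕ j)))

  holdsAtom : (M : Structure) → (ℕ → Dom M) → Atom → Set
  holdsAtom M ρ (atom p _) = rel M p (args M ρ (arity p))

  holdsLit : (M : Structure) → (ℕ → Dom M) → Literal → Set
  holdsLit M ρ (lit true  A) = holdsAtom M ρ A
  holdsLit M ρ (lit false A) = ¬ holdsAtom M ρ A

  holdsClause : (M : Structure) → (ℕ → Dom M) → Clause → Set
  holdsClause M ρ C = Any (holdsLit M ρ) C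

  ConsistentWith : List Literal → (Clause → Set) → Set₁
  ConsistentWith S Δ =
    Σ Structure λ M → Σ (ℕ → Dom M) λ ρ →
      All (holdsLit M ρ) S × (∀ C → Δ C → holdsClause M ρ C)

  Consistent : List Literal → Set₁
  Consistent S = ConsistentWith S (λ _ → ⊥)

  IsType : (Pred k → Set) → List Literal → Set₁
  IsType allowed S =
    All (λ l → allowed (litPred l)) S × Consistent S ×
    (∀ T → All (λ l → allowed (litPred l)) T → S ⊆ T → Consistent T → T ⊆ S)

  IsSigM : Pred k → Set
  IsSigM (sig i) = ar i ≡ m
  IsSigM 𝔱       = ⊥

  AllPreds : Pred k → Set
  AllPreds _ = ⊤

  ReducedPreds : Pred k → Set
  ReducedPreds p = ¬ IsSigM p

  data Star (Γ : List Clause) : Clause → Set where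
    base    : ∀ {C} → C ∈ Γ → Star Γ C
    resolve : ∀ (i : Fin k) → ar i ≡ m → (b b' : ar i ≤ m) → (γ δ : Clause) →
              Star Γ (lit true  (atom (sig i) b)  ∷ γ) →
              Star Γ (lit false (atom (sig i) b') ∷ δ) →
              Star Γ (γ ++ δ)
    same    : ∀ {C D} → C ⊆ D → D ⊆ C → Star Γ C → Star Γ D

  Circ : List Clause → Clause → Set
  Circ Γ C = Star Γ C × All (λ l → ¬ IsSigM (litPred l)) C

{-# OPTIONS --safe #-}
-- Since an m-atom is determined by its predicate, the problem is propositional, with the
-- predicates as variables. Start from the valuation read off τ⁻ and grow a semantic tree
-- by splitting on the m-ary predicates of Σ. If some branch satisfies Γ, it fixes the
-- signs of the m-ary literals and τ⁻ plus these literals is the required type. Otherwise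
-- every branch is closed, and resolving the clauses closing sibling branches on the
-- predicate split there (Davis–Putnam) yields a clause of Γ° false under τ⁻; but a model
-- of τ⁻ and Γ° satisfies one of its literals, which then lies in τ⁻ by maximality.
module Submission where

open import Defs
open import Data.Nat using (ℕ; _≤_)
open import Data.Fin using (Fin)
open import Data.List using (List)
open import Data.List.Membership.Propositional using (_∈_)
open import Data.List.Relation.Binary.Subset.Propositional using (_⊆_)
open import Data.Product using (Σ; _×_)

import Data.Nat as ℕ
open import Data.Nat.Properties using (≤-irrelevant; ≤-reflexive)
import Data.Fin as Fin
open import Data.Bool using (Bool; true; false; not; if_then_else_)
import Data.Bool as Bool
open import Data.Bool.Properties using (¬-not)
open import Data.List using ([]; _∷_; _++_; filter; allFin)
open import Data.List.Relation.Unary.All as All using (All; []; _∷_)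
open import Data.List.Relation.Unary.Any as Any using (Any; here; there)
open import Data.List.Relation.Unary.All.Properties
  using (++⁺; anti-mono; all-filter; ¬All⇒Any¬; ¬Any⇒All¬)
open import Data.List.Membership.Propositional using (find; lose)
open import Data.List.Membership.Propositional.Properties
  using (∈-allFin; ∈-filter⁺; ∈-filter⁻; ∈-++⁺ˡ; ∈-++⁺ʳ)
open import Data.List.Relation.Binary.Subset.Propositional.Properties using (filter-⊆)
open import Data.Product using (_,_; proj₁; proj₂)
open import Data.Sum using (_⊎_; inj₁; inj₂)
open import Data.Empty using (⊥-elim)
open import Data.Unit using (⊤; tt)
open import Relation.Nullary using (¬_; Dec; yes; no; does)
open import Relation.Nullary.Decidable using (¬?; _×-dec_)
open import Relation.Binary.Definitions using (DecidableEquality)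
open import Relation.Binary.PropositionalEquality using (_≡_; _≢_; refl; sym; trans; subst)

_≟ₚ_ : ∀ {k} → DecidableEquality (Pred k)
sig i ≟ₚ sig j with i Fin.≟ j
... | yes refl = yes refl
... | no i≢j   = no λ { refl → i≢j refl }
sig _ ≟ₚ 𝔱     = no λ ()
𝔱     ≟ₚ sig _ = no λ ()
𝔱     ≟ₚ 𝔱     = yes refl

module _ (k : ℕ) (ar : Fin k → ℕ) (m : ℕ) where
  open Fluted k ar m hiding (trans)

  bound-irrelevant : ∀ s p (b b′ : arity p ≤ m) → lit s (atom p b) ≡ lit s (atom p b′)
  bound-irrelevant s p b b′ rewrite ≤-irrelevant b b′ = refl

  holds-sign-unique : ∀ M ρ {s s′ p} {b b′ : arity p ≤ m} →
                      holdsLit M ρ (lit s (atom p b)) → holdsLit M ρ (lit s′ (atom p b′)) →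
                      s ≡ s′
  holds-sign-unique M ρ {true}  {true}  _  _  = refl
  holds-sign-unique M ρ {true}  {false} h  ¬h = ⊥-elim (¬h h)
  holds-sign-unique M ρ {false} {true}  ¬h h  = ⊥-elim (¬h h)
  holds-sign-unique M ρ {false} {false} _  _  = refl

  type-absorbs : ∀ {A S} → IsType A S → ∀ M ρ → All (holdsLit M ρ) S →
                 ∀ {l} → A (litPred l) → holdsLit M ρ l → l ∈ S
  type-absorbs (A-S , _ , maximal) M ρ M⊨S A-l M⊨l =
    maximal (_ ∷ _) (A-l ∷ A-S) there (M , ρ , M⊨l ∷ M⊨S , λ _ ()) (here refl)

  Valuation : Set
  Valuation = Pred k → Bool

  _⊨_ : Valuation → Literal → Set
  v ⊨ l = v (litPred l) ≡ Literal.positive l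

  _⊨?_ : ∀ v l → Dec (v ⊨ l)
  v ⊨? l = v (litPred l) Bool.≟ Literal.positive l

  Satisfies : Valuation → List Clause → Set
  Satisfies v Γ = All (Any (v ⊨_)) Γ

  pointStructure : Valuation → Structure
  pointStructure v = record { Dom = ⊤ ; rel = λ p _ → v p ≡ true ; trans = λ _ _ _ t _ → t }

  point : ℕ → ⊤
  point _ = tt

  ⊨⇒holds : ∀ v {l} → v ⊨ l → holdsLit (pointStructure v) point l
  ⊨⇒holds v {lit true  _} v⊨l = v⊨l
  ⊨⇒holds v {lit false _} v⊨l t with trans (sym v⊨l) t
  ... | ()

  valuationOf : List Literal → Valuation
  valuationOf S p =
    does (Any.any? (λ l → (Literal.positive l Bool.≟ true) ×-dec (litPred l ≟ₚ p)) S)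

  valuationOf-⊨ : ∀ {S} → Consistent S → ∀ {l} → l ∈ S → valuationOf S ⊨ l
  valuationOf-⊨ {S} _ {lit true (atom p _)} l∈S
    with Any.any? (λ l → (Literal.positive l Bool.≟ true) ×-dec (litPred l ≟ₚ p)) S
  ... | yes _    = refl
  ... | no  ¬pos = ⊥-elim (¬pos (lose l∈S (refl , refl)))
  valuationOf-⊨ {S} (M , ρ , M⊨S , _) {lit false (atom p _)} l∈S
    with Any.any? (λ l → (Literal.positive l Bool.≟ true) ×-dec (litPred l ≟ₚ p)) S
  ... | no _    = refl
  ... | yes pos with find pos
  ... | lit true (atom _ _) , l′∈S , refl , refl =
    ⊥-elim (All.lookup M⊨S l∈S (All.lookup M⊨S l′∈S))

  _[_≔_] : Valuation → Fin k → Bool → Valuation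
  (v [ i ≔ b ]) p = if does (p ≟ₚ sig i) then b else v p

  update-same : ∀ v i b → (v [ i ≔ b ]) (sig i) ≡ b
  update-same v i b with sig i ≟ₚ sig i
  ... | yes _   = refl
  ... | no  i≢i = ⊥-elim (i≢i refl)

  update-other : ∀ v i b {p} → p ≢ sig i → (v [ i ≔ b ]) p ≡ v p
  update-other v i b {p} p≢i with p ≟ₚ sig i
  ... | yes p≡i = ⊥-elim (p≢i p≡i)
  ... | no  _   = refl

  falsified-by-update : ∀ v i b {l} (bd : ar i ≤ m) → litPred l ≡ sig i →
                        ¬ (v [ i ≔ b ]) ⊨ l → l ≡ lit (not b) (atom (sig i) bd)
  falsified-by-update v i b {lit s (atom _ b′)} bd refl ¬v⊨l
    rewrite ¬-not (λ s≡b → ¬v⊨l (trans (update-same v i b) (sym s≡b))) =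
      bound-irrelevant (not b) (sig i) b′ bd

  Avoids : List (Fin k) → Pred k → Set
  Avoids U p = ∀ i → i ∈ U → p ≢ sig i

  AgreeOff : List (Fin k) → Valuation → Valuation → Set
  AgreeOff U v v′ = ∀ p → Avoids U p → v′ p ≡ v p

  Refutes : Valuation → List (Fin k) → Clause → Set
  Refutes v U C = All (λ l → Avoids U (litPred l) × ¬ v ⊨ l) C

  agree-update : ∀ {v i b U v′} → AgreeOff U (v [ i ≔ b ]) v′ → AgreeOff (i ∷ U) v v′
  agree-update {v} {i} {b} agree p avoids =
    trans (agree p (λ j j∈U → avoids j (there j∈U)))
          (update-other v i b (avoids i (here refl)))

  refutes-update : ∀ {v i b U C} → All (λ l → litPred l ≢ sig i) C →
                   Refutes (v [ i ≔ b ]) U C → Refutes v (i ∷ U) C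
  refutes-update {v} {i} {b} {U} {C} off-i refuted = All.tabulate lift
    where
      lift : ∀ {l} → l ∈ C → Avoids (i ∷ U) (litPred l) × ¬ v ⊨ l
      lift l∈C with All.lookup off-i l∈C | All.lookup refuted l∈C
      ... | l≢i | avoids , ¬v⊨l =
        (λ { _ (here refl) → l≢i ; j (there j∈U) → avoids j j∈U }) ,
        λ v⊨l → ¬v⊨l (trans (update-other v i b l≢i) v⊨l)

  without : Fin k → Clause → Clause
  without i = filter (λ l → ¬? (litPred l ≟ₚ sig i))

  refutes-without : ∀ {v i b U} C → Refutes (v [ i ≔ b ]) U C → Refutes v (i ∷ U) (without i C)
  refutes-without C refuted =
    refutes-update (all-filter _ C) (anti-mono (filter-⊆ _ C) refuted)

  module _ (Γ : List Clause) where

    isolate : ∀ {v i b U C} (bd : ar i ≤ m) → Any (λ l → litPred l ≡ sig i) C →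
              Refutes (v [ i ≔ b ]) U C → Star Γ C →
              Star Γ (lit (not b) (atom (sig i) bd) ∷ without i C)
    isolate {v} {i} {b} {C = C} bd on-i refuted = same into out-of
      where
        flipped : ∀ {l} → l ∈ C → litPred l ≡ sig i → l ≡ lit (not b) (atom (sig i) bd)
        flipped l∈C l-i = falsified-by-update v i b bd l-i (proj₂ (All.lookup refuted l∈C))

        into : C ⊆ lit (not b) (atom (sig i) bd) ∷ without i C
        into {l} l∈C with litPred l ≟ₚ sig i
        ... | yes l-i = here (flipped l∈C l-i)
        ... | no  l≢i = there (∈-filter⁺ _ l∈C l≢i)

        out-of : lit (not b) (atom (sig i) bd) ∷ without i C ⊆ C
        out-of (here refl) with find on-i
        ... | l , l∈C , l-i = subst (_∈ C) (flipped l∈C l-i) l∈C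
        out-of (there l∈) = proj₁ (∈-filter⁻ _ l∈)

    RefutedBy : Valuation → List (Fin k) → Set
    RefutedBy v U = Σ Clause λ C → Star Γ C × Refutes v U C

    resolve-branches : ∀ {v i U} → ar i ≡ m →
                       RefutedBy (v [ i ≔ true ]) U → RefutedBy (v [ i ≔ false ]) U →
                       RefutedBy v (i ∷ U)
    resolve-branches {i = i} ai (C₁ , C₁∈Γ* , ref₁) (C₂ , C₂∈Γ* , ref₂)
      with Any.any? (λ l → litPred l ≟ₚ sig i) C₁ | Any.any? (λ l → litPred l ≟ₚ sig i) C₂
    ... | no off₁ | _ = C₁ , C₁∈Γ* , refutes-update (¬Any⇒All¬ C₁ off₁) ref₁
    ... | yes _ | no off₂ = C₂ , C₂∈Γ* , refutes-update (¬Any⇒All¬ C₂ off₂) ref₂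
    ... | yes on₁ | yes on₂ =
      without i C₂ ++ without i C₁ ,
      resolve i ai bd bd _ _ (isolate bd on₂ ref₂ C₂∈Γ*) (isolate bd on₁ ref₁ C₁∈Γ*) ,
      ++⁺ (refutes-without C₂ ref₂) (refutes-without C₁ ref₁)
      where bd = ≤-reflexive ai

    semantic-tree : ∀ U → All (λ i → ar i ≡ m) U → ∀ v →
                    (Σ Valuation λ v′ → AgreeOff U v v′ × Satisfies v′ Γ) ⊎ RefutedBy v U
    semantic-tree [] _ v with All.all? (Any.any? (v ⊨?_)) Γ
    ... | yes sat = inj₁ (v , (λ _ _ → refl) , sat)
    ... | no unsat with find (¬All⇒Any¬ (Any.any? (v ⊨?_)) Γ unsat)
    ... | C , C∈Γ , unsatC =
      inj₂ (C , base C∈Γ , All.map (λ ¬v⊨l → (λ _ ()) , ¬v⊨l) (¬Any⇒All¬ C unsatC))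
    semantic-tree (i ∷ U) (ai ∷ U-m) v
      with semantic-tree U U-m (v [ i ≔ true ]) | semantic-tree U U-m (v [ i ≔ false ])
    ... | inj₁ (v′ , agree , sat) | _ = inj₁ (v′ , agree-update agree , sat)
    ... | inj₂ _ | inj₁ (v′ , agree , sat) = inj₁ (v′ , agree-update agree , sat)
    ... | inj₂ ref₁ | inj₂ ref₂ = inj₂ (resolve-branches ai ref₁ ref₂)

  IsSigM? : ∀ p → Dec (IsSigM p)
  IsSigM? (sig i) = ar i ℕ.≟ m
  IsSigM? 𝔱       = no λ ()

  mAry : List (Fin k)
  mAry = filter (λ i → ar i ℕ.≟ m) (allFin k)

  avoids-mAry⇒reduced : ∀ p → Avoids mAry p → ReducedPreds p
  avoids-mAry⇒reduced (sig i) avoids i-m = avoids i (∈-filter⁺ _ (∈-allFin i) i-m) refl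

  reduced⇒avoids-mAry : ∀ p → ReducedPreds p → Avoids mAry p
  reduced⇒avoids-mAry _ reduced i i∈ refl = reduced (proj₂ (∈-filter⁻ _ {xs = allFin k} i∈))

  mLiterals : Valuation → List (Fin k) → List Literal
  mLiterals v [] = []
  mLiterals v (i ∷ is) with ar i ℕ.≟ m
  ... | yes i-m = lit (v (sig i)) (atom (sig i) (≤-reflexive i-m)) ∷ mLiterals v is
  ... | no  _   = mLiterals v is

  mLiterals-⊨ : ∀ v is → All (v ⊨_) (mLiterals v is)
  mLiterals-⊨ v [] = []
  mLiterals-⊨ v (i ∷ is) with ar i ℕ.≟ m
  ... | yes _ = refl ∷ mLiterals-⊨ v is
  ... | no  _ = mLiterals-⊨ v is

  ∈-mLiterals : ∀ v {is i} → i ∈ is → ar i ≡ m → (bd : ar i ≤ m) →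
                lit (v (sig i)) (atom (sig i) bd) ∈ mLiterals v is
  ∈-mLiterals v {j ∷ is} i∈ i-m bd with ar j ℕ.≟ m | i∈
  ... | yes j-m | here refl = here (bound-irrelevant _ (sig j) bd (≤-reflexive j-m))
  ... | yes _   | there i∈′ = there (∈-mLiterals v i∈′ i-m bd)
  ... | no  j≢m | here refl = ⊥-elim (j≢m i-m)
  ... | no  _   | there i∈′ = ∈-mLiterals v i∈′ i-m bd

  extension : Valuation → List Literal → List Literal
  extension v τ⁻ = τ⁻ ++ mLiterals v (allFin k)

  module _ {τ⁻ : List Literal} (τ⁻-type : IsType ReducedPreds τ⁻) where

    τ⁻-consistent : Consistent τ⁻
    τ⁻-consistent = proj₁ (proj₂ τ⁻-type)

    extension-⊨ : ∀ {v} → AgreeOff mAry (valuationOf τ⁻) v → All (v ⊨_) (extension v τ⁻)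
    extension-⊨ {v} agree = ++⁺ (All.tabulate τ⁻-⊨) (mLiterals-⊨ v (allFin k))
      where
        τ⁻-⊨ : ∀ {l} → l ∈ τ⁻ → v ⊨ l
        τ⁻-⊨ {l} l∈τ⁻ =
          trans (agree (litPred l) (reduced⇒avoids-mAry _ (All.lookup (proj₁ τ⁻-type) l∈τ⁻)))
                (valuationOf-⊨ τ⁻-consistent l∈τ⁻)

    extension-maximal : ∀ v T → extension v τ⁻ ⊆ T → Consistent T → T ⊆ extension v τ⁻
    extension-maximal v T ext⊆T (N , σ , N⊨T , _) {lit s (atom p b)} l∈T with IsSigM? p
    ... | no reduced =
      ∈-++⁺ˡ (type-absorbs τ⁻-type N σ (anti-mono (λ l∈τ⁻ → ext⊆T (∈-++⁺ˡ l∈τ⁻)) N⊨T)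
                           reduced (All.lookup N⊨T l∈T))
    extension-maximal v T ext⊆T (N , σ , N⊨T , _) {lit s (atom (sig i) b)} l∈T | yes i-m =
      subst (λ s → lit s (atom (sig i) b) ∈ extension v τ⁻) (sym s≡v) v-lit∈ext
      where
        v-lit∈ext = ∈-++⁺ʳ τ⁻ (∈-mLiterals v (∈-allFin i) i-m b)
        s≡v = holds-sign-unique N σ (All.lookup N⊨T l∈T) (All.lookup N⊨T (ext⊆T v-lit∈ext))

    no-refutation : ∀ {Γ} → ConsistentWith τ⁻ (Circ Γ) → ¬ RefutedBy Γ (valuationOf τ⁻) mAry
    no-refutation (M , ρ , M⊨τ⁻ , M⊨Γ°) (C , C∈Γ* , refuted)
      with find (M⊨Γ° C (C∈Γ* , All.map (λ {l} r → avoids-mAry⇒reduced (litPred l) (proj₁ r)) refuted))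
    ... | l , l∈C , M⊨l with All.lookup refuted l∈C
    ... | avoids , ¬v⊨l =
      ¬v⊨l (valuationOf-⊨ τ⁻-consistent
             (type-absorbs τ⁻-type M ρ M⊨τ⁻ (avoids-mAry⇒reduced _ avoids) M⊨l))

  extend-type : (Γ : List Clause) (τ⁻ : List Literal) →
                IsType ReducedPreds τ⁻ → ConsistentWith τ⁻ (Circ Γ) →
                Σ (List Literal) λ τ →
                  IsType AllPreds τ × τ⁻ ⊆ τ × ConsistentWith τ (λ C → C ∈ Γ)
  extend-type Γ τ⁻ τ⁻-type τ⁻⊨Γ° with semantic-tree Γ mAry (all-filter _ (allFin k)) (valuationOf τ⁻)
  ... | inj₂ refuted = ⊥-elim (no-refutation τ⁻-type τ⁻⊨Γ° refuted)
  ... | inj₁ (v , agree , v⊨Γ) =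
    extension v τ⁻ ,
    (All.tabulate (λ _ → tt) , (pointStructure v , point , point⊨τ , λ _ ()) ,
     λ T _ → extension-maximal τ⁻-type v T) ,
    ∈-++⁺ˡ ,
    pointStructure v , point , point⊨τ , λ C C∈Γ → Any.map (⊨⇒holds v) (All.lookup v⊨Γ C∈Γ)
    where point⊨τ = All.map (⊨⇒holds v) (extension-⊨ τ⁻-type agree)

lemma8 : (k : ℕ) (ar : Fin k → ℕ) → (∀ i → 1 ≤ ar i) →
    (m : ℕ) → 2 ≤ m →
    let open Fluted k ar m in
    (Γ : List Clause) (τ⁻ : List Literal) →
    IsType ReducedPreds τ⁻ →
    ConsistentWith τ⁻ (Circ Γ) →
    Σ (List Literal) λ τ →
    IsType AllPreds τ × τ⁻ ⊆ τ × ConsistentWith τ (λ C → C ∈ Γ)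
lemma8 k ar _ m _ = extend-type k ar m
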